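{- Let $L$ be a complete lattice. If the quantale $(\mathrm{Hom}_{R}(L,L),\circ)$ has a unit (an element $u$ with $u\circ h = h\circ u = h$ for all $h\in \mathrm{Hom}_{R}(L,L)$), then $L$ is completely distributive (in which case $\mathrm{Hom}_{R}(L,L) = \mathrm{Hom}_{\vee}(L,L)$). Equivalently, unless $L$ is completely distributive, $(\mathrm{Hom}_{R}(L,L),\circ)$ is not unital.
   Context: $\mathrm{Hom}_{\vee}(L,L)$ (resp. $\mathrm{Hom}_{\wedge}(L,L)$) is the set of maps $L\to L$ preserving arbitrary joins (resp. meets), ordered pointwise. Raney's transforms: for $g\in \mathrm{Hom}_{\wedge}(L,L)$, $g^{\vee}(x) := \bigvee_{x\not\leq t} g(t)$ (join-preserving); for $f\in\mathrm{Hom}_{\vee}(L,L)$, $f^{\wedge}(x) := \bigwedge_{t\not\leq x} f(t)$ (meet-preserving). $\mathrm{Hom}_{R}(L,L)=\{f \in\mathrm{Hom}_{\vee}(L,L) : (f^{\wedge})^{\vee}=f\}$ is the set of tight maps; with composition it is a (possibly non-unital) quantale. A complete lattice is completely distributive if $\bigwedge_{i\in I}\bigvee_{j\in J_i} z_{i,j} = \bigvee_{s}\bigwedge_{i\in I} z_{i,s(i)}$ for all families, $s$ ranging over choice functions with $s(i)\in J_i$. -}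

module Defs where

open import Level using (Level; suc)
open import Data.Product using (Σ; _×_)
open import Relation.Nullary using (¬_)
open import Relation.Binary.Bundles using (Poset)

record CompleteLattice (ℓ : Level) : Set (suc ℓ) where
  field
    poset : Poset ℓ ℓ ℓ
  open Poset poset public
  field
    ⋁ : {I : Set ℓ} → (I → Carrier) → Carrier
    ⋁-upper : {I : Set ℓ} (f : I → Carrier) (i : I) → f i ≤ ⋁ f
    ⋁-least : {I : Set ℓ} (f : I → Carrier) (z : Carrier) →
              ((i : I) → f i ≤ z) → ⋁ f ≤ z
    ⋀ : {I : Set ℓ} → (I → Carrier) → Carrier
    ⋀-lower : {I : Set ℓ} (f : I → Carrier) (i : I) → ⋀ f ≤ f i
    ⋀-greatest : {I : Set ℓ} (f : I → Carrier) (z : Carrier) →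
                 ((i : I) → z ≤ f i) → z ≤ ⋀ f

module _ {ℓ : Level} (L : CompleteLattice ℓ) where
  open CompleteLattice L

  _≐_ : (Carrier → Carrier) → (Carrier → Carrier) → Set ℓ
  f ≐ g = (x : Carrier) → f x ≈ g x

  record JoinPreserving (f : Carrier → Carrier) : Set (suc ℓ) where
    field
      cong      : {x y : Carrier} → x ≈ y → f x ≈ f y
      preserves : {I : Set ℓ} (g : I → Carrier) → f (⋁ g) ≈ ⋁ (λ i → f (g i))

  _^∨ : (Carrier → Carrier) → Carrier → Carrier
  (g ^∨) x = ⋁ {Σ Carrier (λ t → ¬ (x ≤ t))} (λ p → g (Σ.proj₁ p))

  _^∧ : (Carrier → Carrier) → Carrier → Carrier
  (f ^∧) x = ⋀ {Σ Carrier (λ t → ¬ (t ≤ x))} (λ p → f (Σ.proj₁ p))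

  -- f ∈ Hom_R(L,L): join-preserving with (f^∧)^∨ = f
  record Tight (f : Carrier → Carrier) : Set (suc ℓ) where
    field
      joinPreserving : JoinPreserving f
      tight          : ((f ^∧) ^∨) ≐ f

  IsUnitOfTight : (Carrier → Carrier) → Set (suc ℓ)
  IsUnitOfTight u =
    Tight u × ((h : Carrier → Carrier) → Tight h →
                 ((λ x → u (h x)) ≐ h) × ((λ x → h (u x)) ≐ h))

  CompletelyDistributive : Set (suc ℓ)
  CompletelyDistributive =
    {I : Set ℓ} (J : I → Set ℓ) (z : (i : I) → J i → Carrier) →
    ⋀ (λ i → ⋁ (z i)) ≈ ⋁ {(i : I) → J i} (λ s → ⋀ (λ i → z i (s i)))

-- For b ∈ L the step map σ_b, sending x to ⊥ if x ≤ ⊥ and to b otherwise, is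
-- tight. A unit u of Hom_R(L,L) must fix it, so u b = u (σ_b ⊤) = σ_b ⊤ = b
-- (unless L is trivial): the unit is the identity, and the identity is tight,
-- i.e. x ≤ ⋁_{x ≰ t} ⋀_{s ≰ t} s for every x. This is Raney's characterisation
-- of complete distributivity: for m = ⋀_i ⋁_j z_{ij} and m ≰ t, every row i
-- contains some z_{i,s(i)} ≰ t, so ⋀_{s' ≰ t} s' ≤ ⋀_i z_{i,s(i)}. Applying a
-- join-preserving f to the same inequality shows that f is tight as well.
module Submission where

open import Defs
open import Level using (Level; Lift; lift)
open import Data.Bool using (true; false)
open import Data.Product using (Σ; _×_; _,_; proj₁; proj₂)
open import Function using (id)
open import Axiom.ExcludedMiddle using (ExcludedMiddle)
open import Relation.Nullary using (¬_; yes; no; contradiction)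
open import Relation.Nullary.Decidable using (decidable-stable)
import Data.Empty.Polymorphic as Empty
import Relation.Binary.Reasoning.PartialOrder as PartialOrderReasoning

module CompleteLatticeProperties {ℓ : Level} (L : CompleteLattice ℓ) where
  open CompleteLattice L
  open PartialOrderReasoning poset

  infix 10 _^∧ᴸ _^∧^∨

  _^∧ᴸ : (Carrier → Carrier) → Carrier → Carrier
  f ^∧ᴸ = _^∧ L f

  _^∧^∨ : (Carrier → Carrier) → Carrier → Carrier
  f ^∧^∨ = _^∨ L (_^∧ L f)

  ⊥L : Carrier
  ⊥L = ⋁ {Empty.⊥} (λ ())

  ⊤L : Carrier
  ⊤L = ⋀ {Empty.⊥} (λ ())

  ⊥L-minimum : ∀ x → ⊥L ≤ x
  ⊥L-minimum x = ⋁-least _ x (λ ())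

  ⊤L-maximum : ∀ x → x ≤ ⊤L
  ⊤L-maximum x = ⋀-greatest _ x (λ ())

  ⊤≤⊥⇒≈ : ⊤L ≤ ⊥L → ∀ x y → x ≈ y
  ⊤≤⊥⇒≈ ⊤≤⊥ x y = antisym (bound x y) (bound y x)
    where
    bound : ∀ x y → x ≤ y
    bound x y = trans (⊤L-maximum x) (trans ⊤≤⊥ (⊥L-minimum y))

  ⋁-mono : {I : Set ℓ} (f g : I → Carrier) → (∀ i → f i ≤ g i) → ⋁ f ≤ ⋁ g
  ⋁-mono f g f≤g = ⋁-least f (⋁ g) (λ i → trans (f≤g i) (⋁-upper g i))

  ⋀-mono : {I : Set ℓ} (f g : I → Carrier) → (∀ i → f i ≤ g i) → ⋀ f ≤ ⋀ g
  ⋀-mono f g f≤g = ⋀-greatest g (⋀ f) (λ i → trans (⋀-lower f i) (f≤g i))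

  ⋁⋀≤⋀⋁ : {I : Set ℓ} (J : I → Set ℓ) (z : (i : I) → J i → Carrier) →
          ⋁ {(i : I) → J i} (λ s → ⋀ (λ i → z i (s i))) ≤ ⋀ (λ i → ⋁ (z i))
  ⋁⋀≤⋀⋁ J z = ⋁-least _ _ (λ s → ⋀-greatest _ _ (λ i →
    trans (⋀-lower _ i) (⋁-upper (z i) (s i))))

  ^∧^∨-deflationary : ∀ f x → (f ^∧^∨) x ≤ f x
  ^∧^∨-deflationary f x = ⋁-least _ (f x) (λ (t , x≰t) → ⋀-lower _ (x , x≰t))

  ^∧^∨-mono : ∀ f g → (∀ x → f x ≤ g x) → ∀ x → (f ^∧^∨) x ≤ (g ^∧^∨) x
  ^∧^∨-mono f g f≤g x = ⋁-mono _ _ (λ _ → ⋀-mono _ _ (λ (s , _) → f≤g s))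

  tight-from-≤ : ∀ {f} → JoinPreserving L f → (∀ x → f x ≤ (f ^∧^∨) x) → Tight L f
  tight-from-≤ {f} f-jp f≤ = record
    { joinPreserving = f-jp
    ; tight          = λ x → antisym (^∧^∨-deflationary f x) (f≤ x)
    }

  Tight-resp-≐ : ∀ {f g} → Tight L f → (L ≐ f) g → JoinPreserving L g → Tight L g
  Tight-resp-≐ {f} {g} f-tight f≐g g-jp = tight-from-≤ g-jp λ x → begin
    g x                 ≈⟨ f≐g x ⟨
    f x                 ≈⟨ Tight.tight f-tight x ⟨
    (f ^∧^∨) x          ≤⟨ ^∧^∨-mono f g (λ y → reflexive (f≐g y)) x ⟩
    (g ^∧^∨) x          ∎

  id-joinPreserving : JoinPreserving L id
  id-joinPreserving = record { cong = id ; preserves = λ _ → Eq.refl }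

  module _ {f : Carrier → Carrier} (f-jp : JoinPreserving L f) where
    open JoinPreserving f-jp

    joinPreserving-mono : ∀ {x y} → x ≤ y → f x ≤ f y
    joinPreserving-mono {x} {y} x≤y = begin
      f x                   ≤⟨ ⋁-upper (λ i → f (pair i)) (lift true) ⟩
      ⋁ (λ i → f (pair i))  ≈⟨ preserves pair ⟨
      f (⋁ pair)            ≈⟨ cong (antisym (⋁-least pair y y-bounds) (⋁-upper pair (lift false))) ⟩
      f y                   ∎
      where
      pair : Lift ℓ _ → Carrier
      pair (lift true)  = x
      pair (lift false) = y

      y-bounds : ∀ i → pair i ≤ y
      y-bounds (lift true)  = x≤y
      y-bounds (lift false) = refl

    Tight-id⇒Tight : Tight L id → Tight L f
    Tight-id⇒Tight id-tight = tight-from-≤ f-jp λ x → begin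
      f x                             ≤⟨ joinPreserving-mono (reflexive (Eq.sym (Tight.tight id-tight x))) ⟩
      f ((id ^∧^∨) x)                 ≈⟨ preserves _ ⟩
      ⋁ (λ (t , _) → f ((id ^∧ᴸ) t))  ≤⟨ ⋁-mono _ _ (λ _ → f⋀≤⋀f) ⟩
      (f ^∧^∨) x                      ∎
      where
      f⋀≤⋀f : ∀ {t} → f ((id ^∧ᴸ) t) ≤ (f ^∧ᴸ) t
      f⋀≤⋀f = ⋀-greatest _ _ (λ (s , s≰t) → joinPreserving-mono (⋀-lower proj₁ (s , s≰t)))

  module Classical (em : ExcludedMiddle ℓ) where

    ⋁≰⇒∃≰ : {I : Set ℓ} (f : I → Carrier) {t : Carrier} → ¬ (⋁ f ≤ t) → Σ I (λ i → ¬ (f i ≤ t))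
    ⋁≰⇒∃≰ f {t} ⋁f≰t = decidable-stable em λ ∄ →
      ⋁f≰t (⋁-least f t (λ i → decidable-stable em (λ fi≰t → ∄ (i , fi≰t))))

    Tight-id⇒completelyDistributive : Tight L id → CompletelyDistributive L
    Tight-id⇒completelyDistributive id-tight J z = antisym ⋀⋁≤⋁⋀ (⋁⋀≤⋀⋁ J z)
      where
      m : Carrier
      m = ⋀ (λ i → ⋁ (z i))

      rhs : Carrier
      rhs = ⋁ (λ s → ⋀ (λ i → z i (s i)))

      below-rhs : ∀ {t} → ¬ (m ≤ t) → (id ^∧ᴸ) t ≤ rhs
      below-rhs {t} m≰t = begin
        (id ^∧ᴸ) t           ≤⟨ ⋀-greatest _ _ (λ i → ⋀-lower proj₁ (z i (s i) , proj₂ (witness i))) ⟩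
        ⋀ (λ i → z i (s i))  ≤⟨ ⋁-upper (λ s → ⋀ (λ i → z i (s i))) s ⟩
        rhs                  ∎
        where
        witness : ∀ i → Σ _ (λ j → ¬ (z i j ≤ t))
        witness i = ⋁≰⇒∃≰ (z i) (λ ⋁zi≤t → m≰t (trans (⋀-lower _ i) ⋁zi≤t))

        s : (i : _) → J i
        s i = proj₁ (witness i)

      ⋀⋁≤⋁⋀ : m ≤ rhs
      ⋀⋁≤⋁⋀ = begin
        m            ≈⟨ Tight.tight id-tight m ⟨
        (id ^∧^∨) m  ≤⟨ ⋁-least _ rhs (λ (_ , m≰t) → below-rhs m≰t) ⟩
        rhs          ∎

    by-cases : ∀ {a} {A : Set a} (P : Set ℓ) → (P → A) → (¬ P → A) → A
    by-cases P on-yes on-no with em {P}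
    ... | yes p  = on-yes p
    ... | no ¬p  = on-no ¬p

    step : Carrier → Carrier → Carrier
    step b x with em {x ≤ ⊥L}
    ... | yes _ = ⊥L
    ... | no  _ = b

    step-≤⊥ : ∀ b {x} → x ≤ ⊥L → step b x ≈ ⊥L
    step-≤⊥ b {x} x≤⊥ with em {x ≤ ⊥L}
    ... | yes _   = Eq.refl
    ... | no x≰⊥  = contradiction x≤⊥ x≰⊥

    step-≰⊥ : ∀ b {x} → ¬ (x ≤ ⊥L) → step b x ≈ b
    step-≰⊥ b {x} x≰⊥ with em {x ≤ ⊥L}
    ... | yes x≤⊥ = contradiction x≤⊥ x≰⊥
    ... | no _    = Eq.refl

    step-bounded : ∀ b x → step b x ≤ b
    step-bounded b x with em {x ≤ ⊥L}
    ... | yes _ = ⊥L-minimum b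
    ... | no  _ = refl

    step-joinPreserving : ∀ b → JoinPreserving L (step b)
    step-joinPreserving b = record { cong = step-cong ; preserves = step-preserves }
      where
      step-cong : ∀ {x y} → x ≈ y → step b x ≈ step b y
      step-cong {x} {y} x≈y = by-cases (x ≤ ⊥L)
        (λ x≤⊥ → Eq.trans (step-≤⊥ b x≤⊥) (Eq.sym (step-≤⊥ b (≤-respˡ-≈ x≈y x≤⊥))))
        (λ x≰⊥ → Eq.trans (step-≰⊥ b x≰⊥)
                   (Eq.sym (step-≰⊥ b (λ y≤⊥ → x≰⊥ (≤-respˡ-≈ (Eq.sym x≈y) y≤⊥)))))

      step-preserves : {I : Set ℓ} (g : I → Carrier) → step b (⋁ g) ≈ ⋁ (λ i → step b (g i))
      step-preserves g = by-cases (⋁ g ≤ ⊥L) all-≤⊥ some-≰⊥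
        where
        all-≤⊥ : ⋁ g ≤ ⊥L → step b (⋁ g) ≈ ⋁ (λ i → step b (g i))
        all-≤⊥ ⋁g≤⊥ = antisym (trans (reflexive (step-≤⊥ b ⋁g≤⊥)) (⊥L-minimum _))
          (⋁-least _ _ (λ i → trans (reflexive (step-≤⊥ b (trans (⋁-upper g i) ⋁g≤⊥))) (⊥L-minimum _)))

        some-≰⊥ : ¬ (⋁ g ≤ ⊥L) → step b (⋁ g) ≈ ⋁ (λ i → step b (g i))
        some-≰⊥ ⋁g≰⊥ with ⋁≰⇒∃≰ g ⋁g≰⊥
        ... | i , gi≰⊥ = begin-equality
          step b (⋁ g)            ≈⟨ step-≰⊥ b ⋁g≰⊥ ⟩
          b                       ≈⟨ antisym (trans (reflexive (Eq.sym (step-≰⊥ b gi≰⊥))) (⋁-upper _ i))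
                                             (⋁-least _ b (λ j → step-bounded b (g j))) ⟩
          ⋁ (λ i → step b (g i))  ∎

    step-tight : ∀ b → Tight L (step b)
    step-tight b = tight-from-≤ (step-joinPreserving b) step≤
      where
      step≤ : ∀ x → step b x ≤ (step b ^∧^∨) x
      step≤ x with em {x ≤ ⊥L}
      ... | yes _   = ⊥L-minimum _
      ... | no x≰⊥  = begin
        b                ≤⟨ ⋀-greatest _ b (λ (s , s≰⊥) → reflexive (Eq.sym (step-≰⊥ b s≰⊥))) ⟩
        (step b ^∧ᴸ) ⊥L  ≤⟨ ⋁-upper (λ (t , _) → (step b ^∧ᴸ) t) (⊥L , x≰⊥) ⟩
        (step b ^∧^∨) x  ∎

    unit≐id : ∀ {u} → IsUnitOfTight L u → (L ≐ u) id
    unit≐id {u} (u-tight , u-unit) b with em {⊤L ≤ ⊥L}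
    ... | yes ⊤≤⊥ = ⊤≤⊥⇒≈ ⊤≤⊥ (u b) b
    ... | no ⊤≰⊥  = begin-equality
      u b               ≈⟨ JoinPreserving.cong (Tight.joinPreserving u-tight) (step-≰⊥ b ⊤≰⊥) ⟨
      u (step b ⊤L)     ≈⟨ proj₁ (u-unit (step b) (step-tight b)) ⊤L ⟩
      step b ⊤L         ≈⟨ step-≰⊥ b ⊤≰⊥ ⟩
      b                 ∎

    unit⇒Tight-id : ∀ {u} → IsUnitOfTight L u → Tight L id
    unit⇒Tight-id u-unit = Tight-resp-≐ (proj₁ u-unit) (unit≐id u-unit) id-joinPreserving

mainTheorem5 : {ℓ : Level} → ExcludedMiddle ℓ → (L : CompleteLattice ℓ) →
    (Σ (CompleteLattice.Carrier L → CompleteLattice.Carrier L) (IsUnitOfTight L)) →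
    CompletelyDistributive L
      × ((f : CompleteLattice.Carrier L → CompleteLattice.Carrier L) →
           JoinPreserving L f → Tight L f)
mainTheorem5 em L (u , u-unit) =
  Tight-id⇒completelyDistributive id-tight , λ f f-jp → Tight-id⇒Tight f-jp id-tight
  where
  open CompleteLatticeProperties L
  open Classical em
  id-tight : Tight L id
  id-tight = unit⇒Tight-id u-unit
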